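{- A permutation $\pi$ is $123$-hexagon avoiding if and only if $\pi$ avoids the classical pattern $123$ and the marked mesh pattern $(2143,\mathcal{C})$ where $\mathcal{C}=\{(\{(2,4)\},\ge1),(\{(0,2)\},\ge1),(\{(4,2)\},\ge1),(\{(2,0)\},\ge1)\}$, i.e. each of the four boxes $(2,4)$, $(0,2)$, $(4,2)$, $(2,0)$ contains at least one point.
   Context: A permutation is $123$-hexagon avoiding if it avoids the classical patterns $123$, $53281764$, $53218764$, $43281765$, $43218765$ (a classical pattern $p$ occurs in $\pi$ if $\pi$ has a subsequence whose letters are in the same relative order as those of $p$). Marked mesh patterns: a marked mesh pattern $(p,\mathcal{C})$ of rank $k$ consists of $p\in S_k$ and pairs $(C,\square j)$ with $C\subseteq\{0,\dots,k\}^2$, $j\ge0$, $\square\in\{\le,=,\ge\}$. Given an occurrence of $p$ in $\pi\in S_n$ at positions $i_1<\dots<i_k$ with values $v_1<\dots<v_k$ in increasing order, and $i_0=v_0=0$, $i_{k+1}=v_{k+1}=n+1$, the box $(a,b)$ is the set of points $(t,\pi(t))$ with $i_a<t<i_{a+1}$ and $v_b<\pi(t)<v_{b+1}$. The occurrence is an occurrence of $(p,\mathcal{C})$ if for each $(C,\square j)$ the number of points of the graph of $\pi$ in the union of the boxes of $C$ is $\square\, j$. Avoidance means no occurrence. -}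

module Defs where

open import Data.Nat using (ℕ; zero; suc; _+_; _≤_; _<ᵇ_)
open import Data.Fin using (Fin; toℕ; #_) renaming (_<_ to _<ꟳ_)
open import Data.Fin.Base using (inject₁)
open import Data.Vec using (Vec; []; _∷_; lookup)
open import Data.List using (List; []; _∷_; length; filter)
open import Data.Bool.ListAction using (any)
open import Data.List.Base using (allFin)
open import Data.Bool using (Bool; true; false; _∧_; T)
open import Data.Product using (_×_; _,_; Σ; proj₁; proj₂)
open import Relation.Binary.PropositionalEquality using (_≡_)
open import Relation.Nullary using (¬_)
open import Relation.Nullary.Decidable using (T?)

-- A pattern / permutation of rank k is a map Fin k → Fin k (0-based values).
-- π ∈ S_n is represented as an injective map Fin n → Fin n.

StrictlyIncreasing : ∀ {k n} → (Fin k → Fin n) → Set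
StrictlyIncreasing f = ∀ a b → a <ꟳ b → f a <ꟳ f b

record Occurrence {k n : ℕ} (p : Fin k → Fin k) (π : Fin n → Fin n) : Set where
  field
    pos     : Fin k → Fin n
    val     : Fin k → Fin n
    pos-inc : StrictlyIncreasing pos
    val-inc : StrictlyIncreasing val
    match   : ∀ a → π (pos a) ≡ val (p a)

Avoids : ∀ {k n} → (Fin k → Fin k) → (Fin n → Fin n) → Set
Avoids p π = ¬ Occurrence p π

-- Boundaries in 1-based coordinates: index 0 ↦ 0, index a ∈ 1..k ↦ (a-th
-- entry)+1 (1-based), index k+1 ↦ n+1.
bound : ∀ {k} (n : ℕ) → (Fin k → Fin n) → Fin (suc (suc k)) → ℕ
bound {k} n f Fin.zero = 0
bound {zero} n f (Fin.suc Fin.zero) = suc n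
bound {suc k} n f (Fin.suc Fin.zero) = suc (toℕ (f Fin.zero))
bound {suc k} n f (Fin.suc (Fin.suc a)) = bound n (λ x → f (Fin.suc x)) (Fin.suc a)

-- The point (t, π t) (1-based: (t+1, π t + 1)) lies in box (a, b) of occurrence o
inBox : ∀ {k n} {p : Fin k → Fin k} {π : Fin n → Fin n} →
        Occurrence p π → Fin (suc k) × Fin (suc k) → Fin n → Bool
inBox {n = n} {π = π} o (a , b) t =
  (bound n pos (inject₁ a) <ᵇ suc (toℕ t)) ∧ (suc (toℕ t) <ᵇ bound n pos (Fin.suc a)) ∧
  (bound n val (inject₁ b) <ᵇ suc (toℕ (π t))) ∧ (suc (toℕ (π t)) <ᵇ bound n val (Fin.suc b))
  where open Occurrence o

countIn : ∀ {k n} {p : Fin k → Fin k} {π : Fin n → Fin n} →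
          Occurrence p π → List (Fin (suc k) × Fin (suc k)) → ℕ
countIn {n = n} o C = length (filter (λ t → T? (any (λ c → inBox o c t) C)) (allFin n))

data Cmp : Set where
  le eq ge : Cmp

holds : Cmp → ℕ → ℕ → Set
holds le m j = m ≤ j
holds eq m j = m ≡ j
holds ge m j = j ≤ m

record MarkedMeshPattern (k : ℕ) : Set where
  field
    pat  : Fin k → Fin k
    cons : List (List (Fin (suc k) × Fin (suc k)) × Cmp × ℕ)

data AllCons {k n} {p : Fin k → Fin k} {π : Fin n → Fin n} (o : Occurrence p π) :
     List (List (Fin (suc k) × Fin (suc k)) × Cmp × ℕ) → Set where
  []  : AllCons o []
  _∷_ : ∀ {C c j cs} → holds c (countIn o C) j → AllCons o cs → AllCons o ((C , c , j) ∷ cs)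

MeshOccurrence : ∀ {k n} → MarkedMeshPattern k → (Fin n → Fin n) → Set
MeshOccurrence P π = Σ (Occurrence (MarkedMeshPattern.pat P) π)
                       (λ o → AllCons o (MarkedMeshPattern.cons P))

AvoidsMesh : ∀ {k n} → MarkedMeshPattern k → (Fin n → Fin n) → Set
AvoidsMesh P π = ¬ MeshOccurrence P π

-- patterns, written 0-based
p123 : Fin 3 → Fin 3
p123 = lookup (# 0 ∷ # 1 ∷ # 2 ∷ [])

p53281764 p53218764 p43281765 p43218765 : Fin 8 → Fin 8
p53281764 = lookup (# 4 ∷ # 2 ∷ # 1 ∷ # 7 ∷ # 0 ∷ # 6 ∷ # 5 ∷ # 3 ∷ [])
p53218764 = lookup (# 4 ∷ # 2 ∷ # 1 ∷ # 0 ∷ # 7 ∷ # 6 ∷ # 5 ∷ # 3 ∷ [])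
p43281765 = lookup (# 3 ∷ # 2 ∷ # 1 ∷ # 7 ∷ # 0 ∷ # 6 ∷ # 5 ∷ # 4 ∷ [])
p43218765 = lookup (# 3 ∷ # 2 ∷ # 1 ∷ # 0 ∷ # 7 ∷ # 6 ∷ # 5 ∷ # 4 ∷ [])

HexagonAvoiding123 : ∀ {n} → (Fin n → Fin n) → Set
HexagonAvoiding123 π =
  Avoids p123 π × Avoids p53281764 π × Avoids p53218764 π ×
  Avoids p43281765 π × Avoids p43218765 π

p2143 : Fin 4 → Fin 4
p2143 = lookup (# 1 ∷ # 0 ∷ # 3 ∷ # 2 ∷ [])

mesh2143 : MarkedMeshPattern 4
mesh2143 = record
  { pat  = p2143
  ; cons = ((# 2 , # 4) ∷ [] , ge , 1) ∷ ((# 0 , # 2) ∷ [] , ge , 1) ∷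
           ((# 4 , # 2) ∷ [] , ge , 1) ∷ ((# 2 , # 0) ∷ [] , ge , 1) ∷ []
  }

module Submission where

-- A mesh occurrence of (2143, C) is a "hexagon": a 2143 at i₁ < i₂ < i₃ < i₄ together with a
-- point above it between i₂ and i₃, a point below it between i₂ and i₃, and points left of i₁
-- and right of i₄ whose values lie between π i₁ and π i₄.  Read in position order these eight
-- points are left, i₁, i₂, {top, bottom}, i₃, i₄, right, with values ordered as
-- bottom, i₂, i₁, {left, right}, i₄, i₃, top; the two undetermined comparisons (top against
-- bottom in position, left against right in value, the latter strict by injectivity) give
-- exactly the four patterns 53281764, 53218764, 43281765, 43218765.  Conversely, in each of
-- these patterns the entries in positions 2, 3, 6, 7 form a 2143 whose four boxes are filled
-- by the remaining entries.

open import Defs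
open import Data.Bool using (T; _∨_; false)
open import Data.Bool.Properties using (T-∧; ∨-identityʳ)
open import Data.Empty using (⊥-elim)
open import Data.Fin using (Fin; toℕ; inject₁; #_; _<_)
open import Data.Fin.Properties using (toℕ<n; <-trans; <-cmp; <-irrefl)
open import Data.List using (List; []; _∷_; length; filter; allFin)
open import Data.List.Membership.Propositional using (lose)
open import Data.List.Membership.Propositional.Properties using (∈-filter⁻; ∈-allFin)
open import Data.List.Properties using (filter-some)
open import Data.List.Relation.Unary.Any using (Any; here; satisfied)
open import Data.Nat as ℕ using (ℕ; suc; _<ᵇ_; z<s; s<s; s<s⁻¹)
open import Data.Nat.Properties using (<ᵇ⇒<; <⇒<ᵇ)
open import Data.Product using (_×_; _,_; ∃; uncurry)
open import Data.Product.Function.NonDependent.Propositional using (_×-⇔_)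
open import Data.Sum using (_⊎_; inj₁; inj₂; [_,_])
open import Data.Vec using (Vec; []; _∷_; lookup; tabulate)
open import Data.Vec.Properties using (lookup∘tabulate)
open import Data.Vec.Relation.Unary.Linked using (Linked; []; [-]; _∷_)
open import Data.Vec.Relation.Unary.Linked.Properties using (lookup⁺)
open import Function using (_∘_; flip)
open import Function.Bundles using (_⇔_; mk⇔; Equivalence)
open import Function.Construct.Composition using (_⇔-∘_)
open import Function.Definitions using (Injective)
open import Relation.Binary.Definitions using (tri<; tri≈; tri>)
open import Relation.Binary.PropositionalEquality using (_≡_; refl; sym; cong; subst; subst₂; module ≡-Reasoning)
open import Relation.Nullary using (Dec)

open Equivalence using (to; from)

private variable
  k n : ℕ

infix 4 _≺_

_≺_ : Fin k → Fin k → Set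
i ≺ j = T (toℕ i <ᵇ toℕ j)

≺⇒< : {i j : Fin k} → i ≺ j → i < j
≺⇒< {i = i} {j} = <ᵇ⇒< (toℕ i) (toℕ j)

T-<ᵇ : ∀ {m n} → T (m <ᵇ n) ⇔ m ℕ.< n
T-<ᵇ = mk⇔ (<ᵇ⇒< _ _) <⇒<ᵇ

1≤length-filter⇔Any : ∀ {A : Set} {P : A → Set} (P? : ∀ x → Dec (P x)) {xs : List A} →
                       1 ℕ.≤ length (filter P? xs) ⇔ Any P xs
1≤length-filter⇔Any P? {xs} = mk⇔ nonempty (filter-some P?)
  where
  nonempty : 1 ℕ.≤ length (filter P? xs) → Any _ xs
  nonempty with filter P? xs | (λ {v} → ∈-filter⁻ P? {v = v} {xs = xs})
  ... | _ ∷ _ | ∈⁻ = λ _ → uncurry lose (∈⁻ (here refl))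

module _ {π : Fin n → Fin n} where

  -- The matching condition is stated on tabulated vectors so that, for explicitly listed
  -- points, it holds by refl.
  occurrence : ∀ {q : Fin k → Fin k} (ι ν : Vec (Fin n) k) → Linked _<_ ι → Linked _<_ ν →
               tabulate (π ∘ lookup ι) ≡ tabulate (lookup ν ∘ q) → Occurrence q π
  occurrence {q = q} ι ν ι↑ ν↑ π∘ι≡ν∘q = record
    { pos     = lookup ι
    ; val     = lookup ν
    ; pos-inc = λ _ _ → lookup⁺ <-trans ι↑
    ; val-inc = λ _ _ → lookup⁺ <-trans ν↑
    ; match   = match
    }
    where
    open ≡-Reasoning
    match : ∀ a → π (lookup ι a) ≡ lookup ν (q a)
    match a = begin
      π (lookup ι a)                         ≡⟨ lookup∘tabulate (π ∘ lookup ι) a ⟨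
      lookup (tabulate (π ∘ lookup ι)) a     ≡⟨ cong (flip lookup a) π∘ι≡ν∘q ⟩
      lookup (tabulate (lookup ν ∘ q)) a     ≡⟨ lookup∘tabulate (lookup ν ∘ q) a ⟩
      lookup ν (q a)                         ∎

module _ {q : Fin k → Fin k} {π : Fin n → Fin n} (o : Occurrence q π) where
  open Occurrence o

  pos-< : (i j : Fin k) {_ : i ≺ j} → pos i < pos j
  pos-< i j {i≺j} = pos-inc i j (≺⇒< i≺j)

  π∘pos-< : (i j : Fin k) {_ : q i ≺ q j} → π (pos i) < π (pos j)
  π∘pos-< i j {qi≺qj} = subst₂ _<_ (sym (match i)) (sym (match j)) (val-inc _ _ (≺⇒< qi≺qj))

  -- Box boundaries are 1-based, hence the successors.
  InBox : Fin (suc k) × Fin (suc k) → Fin n → Set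
  InBox (a , b) t =
    bound n pos (inject₁ a) ℕ.< suc (toℕ t) × suc (toℕ t) ℕ.< bound n pos (Fin.suc a) ×
    bound n val (inject₁ b) ℕ.< suc (toℕ (π t)) × suc (toℕ (π t)) ℕ.< bound n val (Fin.suc b)

  T-inBox⇔InBox : ∀ {c t} → T (inBox o c t) ⇔ InBox c t
  T-inBox⇔InBox = (T-<ᵇ ×-⇔ (T-<ᵇ ×-⇔ (T-<ᵇ ×-⇔ T-<ᵇ) ⇔-∘ T-∧) ⇔-∘ T-∧) ⇔-∘ T-∧

  1≤countIn⇔∃InBox : ∀ c → 1 ℕ.≤ countIn o (c ∷ []) ⇔ ∃ (InBox c)
  1≤countIn⇔∃InBox c = mk⇔ exists occupied ⇔-∘ 1≤length-filter⇔Any _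
    where
    exists : Any (λ t → T (inBox o c t ∨ false)) (allFin n) → ∃ (InBox c)
    exists any with t , t∈c ← satisfied any =
      t , to T-inBox⇔InBox (subst T (∨-identityʳ _) t∈c)
    occupied : ∃ (InBox c) → Any (λ t → T (inBox o c t ∨ false)) (allFin n)
    occupied (t , t∈c) = lose (∈-allFin t) (subst T (sym (∨-identityʳ _)) (from T-inBox⇔InBox t∈c))

record Hexagon (π : Fin n → Fin n) : Set where
  field
    i₁ i₂ i₃ i₄ top left right bottom : Fin n
    i₁<i₂       : i₁ < i₂
    i₂<i₃       : i₂ < i₃
    i₃<i₄       : i₃ < i₄
    πi₂<πi₁     : π i₂ < π i₁
    πi₁<πi₄     : π i₁ < π i₄
    πi₄<πi₃     : π i₄ < π i₃
    i₂<top      : i₂ < top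
    top<i₃      : top < i₃
    πi₃<πtop    : π i₃ < π top
    left<i₁     : left < i₁
    πi₁<πleft   : π i₁ < π left
    πleft<πi₄   : π left < π i₄
    i₄<right    : i₄ < right
    πi₁<πright  : π i₁ < π right
    πright<πi₄  : π right < π i₄
    i₂<bottom   : i₂ < bottom
    bottom<i₃   : bottom < i₃
    πbottom<πi₂ : π bottom < π i₂

module _ {π : Fin n → Fin n} where

  meshOccurrence⇒hexagon : MeshOccurrence mesh2143 π → Hexagon π
  meshOccurrence⇒hexagon (o , top∈ ∷ left∈ ∷ right∈ ∷ bottom∈ ∷ [])
    with top    , i₂<top , top<i₃ , πi₃<πtop , _ ← to (1≤countIn⇔∃InBox o (# 2 , # 4)) top∈
       | left   , _ , left<i₁ , πi₁<πleft , πleft<πi₄ ← to (1≤countIn⇔∃InBox o (# 0 , # 2)) left∈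
       | right  , i₄<right , _ , πi₁<πright , πright<πi₄ ← to (1≤countIn⇔∃InBox o (# 4 , # 2)) right∈
       | bottom , i₂<bottom , bottom<i₃ , _ , πbottom<πi₂ ← to (1≤countIn⇔∃InBox o (# 2 , # 0)) bottom∈
    = record
    { i₁ = pos (# 0) ; i₂ = pos (# 1) ; i₃ = pos (# 2) ; i₄ = pos (# 3)
    ; top = top ; left = left ; right = right ; bottom = bottom
    ; i₁<i₂ = pos-< o (# 0) (# 1) ; i₂<i₃ = pos-< o (# 1) (# 2) ; i₃<i₄ = pos-< o (# 2) (# 3)
    ; πi₂<πi₁ = π∘pos-< o (# 1) (# 0) ; πi₁<πi₄ = π∘pos-< o (# 0) (# 3)
    ; πi₄<πi₃ = π∘pos-< o (# 3) (# 2)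
    ; i₂<top = s<s⁻¹ i₂<top ; top<i₃ = s<s⁻¹ top<i₃ ; πi₃<πtop = above (# 2) πi₃<πtop
    ; left<i₁ = s<s⁻¹ left<i₁ ; πi₁<πleft = above (# 0) πi₁<πleft
    ; πleft<πi₄ = below (# 3) πleft<πi₄
    ; i₄<right = s<s⁻¹ i₄<right ; πi₁<πright = above (# 0) πi₁<πright
    ; πright<πi₄ = below (# 3) πright<πi₄
    ; i₂<bottom = s<s⁻¹ i₂<bottom ; bottom<i₃ = s<s⁻¹ bottom<i₃
    ; πbottom<πi₂ = below (# 1) πbottom<πi₂
    }
    where
    open Occurrence o
    above : ∀ i {t} → suc (toℕ (val (p2143 i))) ℕ.< suc (toℕ (π t)) → π (pos i) < π t
    above i {t} = subst (_< π t) (sym (match i)) ∘ s<s⁻¹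
    below : ∀ i {t} → suc (toℕ (π t)) ℕ.< suc (toℕ (val (p2143 i))) → π t < π (pos i)
    below i {t} = subst (π t <_) (sym (match i)) ∘ s<s⁻¹

  hexagon⇒meshOccurrence : Hexagon π → MeshOccurrence mesh2143 π
  hexagon⇒meshOccurrence h =
    o , occupied (# 2 , # 4) top (s<s i₂<top , s<s top<i₃ , s<s πi₃<πtop , s<s (toℕ<n (π top)))
      ∷ occupied (# 0 , # 2) left (z<s , s<s left<i₁ , s<s πi₁<πleft , s<s πleft<πi₄)
      ∷ occupied (# 4 , # 2) right (s<s i₄<right , s<s (toℕ<n right) , s<s πi₁<πright , s<s πright<πi₄)
      ∷ occupied (# 2 , # 0) bottom (s<s i₂<bottom , s<s bottom<i₃ , z<s , s<s πbottom<πi₂)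
      ∷ []
    where
    open Hexagon h
    o : Occurrence p2143 π
    o = occurrence (i₁ ∷ i₂ ∷ i₃ ∷ i₄ ∷ []) (π i₂ ∷ π i₁ ∷ π i₄ ∷ π i₃ ∷ [])
                   (i₁<i₂ ∷ i₂<i₃ ∷ i₃<i₄ ∷ [-]) (πi₂<πi₁ ∷ πi₁<πi₄ ∷ πi₄<πi₃ ∷ [-]) refl
    occupied : ∀ c t → InBox o c t → 1 ℕ.≤ countIn o (c ∷ [])
    occupied c t t∈c = from (1≤countIn⇔∃InBox o c) (t , t∈c)

  occurrence⇒hexagon : {q : Fin 8 → Fin 8} (o : Occurrence q π) (t b : Fin 8) →
    {2≺t : # 2 ≺ t} {t≺5 : t ≺ # 5} {2≺b : # 2 ≺ b} {b≺5 : b ≺ # 5} →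
    {q2≺q1 : q (# 2) ≺ q (# 1)} {q1≺q6 : q (# 1) ≺ q (# 6)} {q6≺q5 : q (# 6) ≺ q (# 5)} →
    {q5≺qt : q (# 5) ≺ q t} {q1≺q0 : q (# 1) ≺ q (# 0)} {q0≺q6 : q (# 0) ≺ q (# 6)} →
    {q1≺q7 : q (# 1) ≺ q (# 7)} {q7≺q6 : q (# 7) ≺ q (# 6)} {qb≺q2 : q b ≺ q (# 2)} →
    Hexagon π
  occurrence⇒hexagon o t b {2≺t} {t≺5} {2≺b} {b≺5}
                     {q2≺q1} {q1≺q6} {q6≺q5} {q5≺qt} {q1≺q0} {q0≺q6} {q1≺q7} {q7≺q6} {qb≺q2} =
    record
    { i₁ = pos (# 1) ; i₂ = pos (# 2) ; i₃ = pos (# 5) ; i₄ = pos (# 6)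
    ; top = pos t ; left = pos (# 0) ; right = pos (# 7) ; bottom = pos b
    ; i₁<i₂ = pos-< o (# 1) (# 2) ; i₂<i₃ = pos-< o (# 2) (# 5) ; i₃<i₄ = pos-< o (# 5) (# 6)
    ; πi₂<πi₁ = π∘pos-< o (# 2) (# 1) {q2≺q1} ; πi₁<πi₄ = π∘pos-< o (# 1) (# 6) {q1≺q6}
    ; πi₄<πi₃ = π∘pos-< o (# 6) (# 5) {q6≺q5}
    ; i₂<top = pos-< o (# 2) t {2≺t} ; top<i₃ = pos-< o t (# 5) {t≺5}
    ; πi₃<πtop = π∘pos-< o (# 5) t {q5≺qt}
    ; left<i₁ = pos-< o (# 0) (# 1) ; πi₁<πleft = π∘pos-< o (# 1) (# 0) {q1≺q0}
    ; πleft<πi₄ = π∘pos-< o (# 0) (# 6) {q0≺q6}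
    ; i₄<right = pos-< o (# 6) (# 7) ; πi₁<πright = π∘pos-< o (# 1) (# 7) {q1≺q7}
    ; πright<πi₄ = π∘pos-< o (# 7) (# 6) {q7≺q6}
    ; i₂<bottom = pos-< o (# 2) b {2≺b} ; bottom<i₃ = pos-< o b (# 5) {b≺5}
    ; πbottom<πi₂ = π∘pos-< o b (# 2) {qb≺q2}
    }
    where open Occurrence o

  HexagonPatternOccurrence : Set
  HexagonPatternOccurrence = Occurrence p53281764 π ⊎ Occurrence p53218764 π ⊎
                             Occurrence p43281765 π ⊎ Occurrence p43218765 π

  hexagonPatternOccurrence⇒hexagon : HexagonPatternOccurrence → Hexagon π
  hexagonPatternOccurrence⇒hexagon (inj₁ o)               = occurrence⇒hexagon o (# 3) (# 4)
  hexagonPatternOccurrence⇒hexagon (inj₂ (inj₁ o))        = occurrence⇒hexagon o (# 4) (# 3)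
  hexagonPatternOccurrence⇒hexagon (inj₂ (inj₂ (inj₁ o))) = occurrence⇒hexagon o (# 3) (# 4)
  hexagonPatternOccurrence⇒hexagon (inj₂ (inj₂ (inj₂ o))) = occurrence⇒hexagon o (# 4) (# 3)

  module _ (h : Hexagon π) where
    open Hexagon h

    πbottom<πtop : π bottom < π top
    πbottom<πtop = <-trans πbottom<πi₂ (<-trans πi₂<πi₁ (<-trans πi₁<πi₄ (<-trans πi₄<πi₃ πi₃<πtop)))

    left<right : left < right
    left<right = <-trans left<i₁ (<-trans i₁<i₂ (<-trans i₂<i₃ (<-trans i₃<i₄ i₄<right)))

    -- The eight points in position order, with top and bottom as u, v in some order and the
    -- values of left and right as π x, π y in some order.
    hexagonOccurrence : ∀ {q : Fin 8 → Fin 8} {u v x y} →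
      i₂ < u → u < v → v < i₃ → π i₁ < π x → π x < π y → π y < π i₄ →
      tabulate (π ∘ lookup (left ∷ i₁ ∷ i₂ ∷ u ∷ v ∷ i₃ ∷ i₄ ∷ right ∷ [])) ≡
      tabulate (lookup (π bottom ∷ π i₂ ∷ π i₁ ∷ π x ∷ π y ∷ π i₄ ∷ π i₃ ∷ π top ∷ []) ∘ q) →
      Occurrence q π
    hexagonOccurrence i₂<u u<v v<i₃ πi₁<πx πx<πy πy<πi₄ = occurrence _ _
      (left<i₁ ∷ i₁<i₂ ∷ i₂<u ∷ u<v ∷ v<i₃ ∷ i₃<i₄ ∷ i₄<right ∷ [-])
      (πbottom<πi₂ ∷ πi₂<πi₁ ∷ πi₁<πx ∷ πx<πy ∷ πy<πi₄ ∷ πi₄<πi₃ ∷ πi₃<πtop ∷ [-])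

  module _ (inj : Injective _≡_ _≡_ π) (h : Hexagon π) where
    open Hexagon h

    hexagon⇒hexagonPatternOccurrence : HexagonPatternOccurrence
    hexagon⇒hexagonPatternOccurrence with <-cmp top bottom | <-cmp (π left) (π right)
    ... | tri≈ _ top≡bottom _ | _ = ⊥-elim (<-irrefl (cong π (sym top≡bottom)) (πbottom<πtop h))
    ... | _ | tri≈ _ πleft≡πright _ = ⊥-elim (<-irrefl (inj πleft≡πright) (left<right h))
    ... | tri< top<bottom _ _ | tri> _ _ πright<πleft = inj₁
      (hexagonOccurrence h i₂<top top<bottom bottom<i₃ πi₁<πright πright<πleft πleft<πi₄ refl)
    ... | tri> _ _ bottom<top | tri> _ _ πright<πleft = inj₂ (inj₁
      (hexagonOccurrence h i₂<bottom bottom<top top<i₃ πi₁<πright πright<πleft πleft<πi₄ refl))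
    ... | tri< top<bottom _ _ | tri< πleft<πright _ _ = inj₂ (inj₂ (inj₁
      (hexagonOccurrence h i₂<top top<bottom bottom<i₃ πi₁<πleft πleft<πright πright<πi₄ refl)))
    ... | tri> _ _ bottom<top | tri< πleft<πright _ _ = inj₂ (inj₂ (inj₂
      (hexagonOccurrence h i₂<bottom bottom<top top<i₃ πi₁<πleft πleft<πright πright<πi₄ refl)))

proposition4 : (n : ℕ) (π : Fin n → Fin n) → Injective _≡_ _≡_ π →
    (HexagonAvoiding123 π ⇔ (Avoids p123 π × AvoidsMesh mesh2143 π))
proposition4 n π inj = mk⇔
  (λ (avoids123 , avoids₁ , avoids₂ , avoids₃ , avoids₄) →
     avoids123 ,
     [ avoids₁ , [ avoids₂ , [ avoids₃ , avoids₄ ] ] ]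
       ∘ hexagon⇒hexagonPatternOccurrence inj ∘ meshOccurrence⇒hexagon)
  (λ (avoids123 , avoidsMesh) →
     let avoids = λ {q} (embed : Occurrence q π → HexagonPatternOccurrence) →
                    avoidsMesh ∘ hexagon⇒meshOccurrence ∘ hexagonPatternOccurrence⇒hexagon ∘ embed
     in avoids123 , avoids inj₁ , avoids (inj₂ ∘ inj₁) , avoids (inj₂ ∘ inj₂ ∘ inj₁) ,
        avoids (inj₂ ∘ inj₂ ∘ inj₂))
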